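{- For every integer $n\ge 1$, the number of Dumont permutations of the second kind of length $2n$ that avoid the pattern $231$ equals $2^{n-1}$, i.e. $|\mathfrak D^2_{2n}(231)|=2^{n-1}$.
   Context: A permutation $\sigma\in\mathfrak S_m$ contains a pattern $\tau\in\mathfrak S_k$ if $\sigma$ has a subsequence $(\sigma(i_1),\dots,\sigma(i_k))$, $i_1<\dots<i_k$, order-isomorphic to $\tau$; otherwise $\sigma$ avoids $\tau$. A Dumont permutation of the second kind of length $2n$ is a permutation $\pi\in\mathfrak S_{2n}$ in which every entry at an even position is a deficiency and every entry at an odd position is a fixed point or an excedance, i.e. $\pi(2i)<2i$ for $1\le i\le n$ and $\pi(2i-1)\ge 2i-1$ for $1\le i\le n$. $\mathfrak D^2_{2n}(\tau)$ denotes the set of such permutations avoiding $\tau$. -}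

module Defs where

open import Data.Nat using (ℕ; suc; _*_; _<_; _≤_; _≥_)
open import Data.Nat.DivMod using (_%_)
open import Data.Fin using (Fin; toℕ) renaming (_<_ to _<ᶠ_)
open import Data.Vec using (Vec; lookup)
open import Data.Product using (∃; _×_; Σ-syntax)
open import Data.List using (List; length)
open import Data.List.Membership.Propositional using (_∈_)
open import Data.List.Relation.Unary.Unique.Propositional using (Unique)
open import Function.Definitions using (Injective)
open import Relation.Binary.PropositionalEquality using (_≡_)
open import Relation.Nullary using (¬_)
open import Function.Bundles using (_⇔_)

-- A permutation of {1..m} in one-line notation, stored 0-indexed:
-- the vector (π(1)-1, …, π(m)-1), required to be injective (hence bijective).
IsPerm : {m : ℕ} → Vec (Fin m) m → Set
IsPerm v = Injective _≡_ _≡_ (lookup v)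

Contains231 : {m : ℕ} → Vec (Fin m) m → Set
Contains231 {m} v = ∃ λ (i : Fin m) → ∃ λ (j : Fin m) → ∃ λ (k : Fin m) →
  (i <ᶠ j) × (j <ᶠ k) × (lookup v k <ᶠ lookup v i) × (lookup v i <ᶠ lookup v j)

Avoids231 : {m : ℕ} → Vec (Fin m) m → Set
Avoids231 v = ¬ Contains231 v

-- Dumont condition of the second kind, translated to 0-indexing:
-- position p = toℕ x + 1, value π(p) = toℕ (v x) + 1.
-- p even (x odd): π(p) < p  ⇔ toℕ (v x) < toℕ x;
-- p odd (x even): π(p) ≥ p ⇔ toℕ (v x) ≥ toℕ x.
IsDumont2 : {m : ℕ} → Vec (Fin m) m → Set
IsDumont2 {m} v = (x : Fin m) →
  (toℕ x % 2 ≡ 1 → toℕ (lookup v x) < toℕ x) × (toℕ x % 2 ≡ 0 → toℕ (lookup v x) ≥ toℕ x)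

InD2-231 : (n : ℕ) → Vec (Fin (2 * n)) (2 * n) → Set
InD2-231 n v = IsPerm v × IsDumont2 v × Avoids231 v

HasCard : {A : Set} → (A → Set) → ℕ → Set
HasCard {A} P N = Σ[ xs ∈ List A ] (Unique xs × ((x : A) → (x ∈ xs ⇔ P x)) × length xs ≡ N)

{-# OPTIONS --safe #-}
-- Let σ ∈ 𝔇²_{2n+2}(231). Its entry at position 2n+1 is at least 2n+1 and its last entry is below
-- 2n+2, so σ ends in a descent, and a value strictly between these two entries would occur earlier
-- and form a 231 with them. Hence σ ends in (2n+2, 2n+1) or in (2n+1, 2n). In the first case
-- σ = π ⊕ 21; in the second, σ is obtained from π by replacing its largest entry 2n by 2n+2 and
-- appending 2n+1, 2n. In both cases π ∈ 𝔇²_{2n}(231) is recovered by deleting the last two entries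
-- and lowering the remaining entries above 2n to 2n, and both constructions preserve the Dumont
-- conditions and 231-avoidance. So |𝔇²_{2n+2}(231)| = 2 |𝔇²_{2n}(231)|, while 𝔇²_2(231) = {21}.
module Submission where

open import Defs
open import Data.Nat using (ℕ; suc; _^_)

open import Data.Nat using (zero; _+_; _*_; _≤_; _<_; _⊓_; z≤n; s≤s; s≤s⁻¹; _<?_)
open import Data.Nat.Properties
  using (≤-refl; ≤-trans; ≤-antisym; <-trans; <-irrefl; <⇒≤; <⇒≢; ≤⇒≯; ≤-<-trans; ≤∧≢⇒<;
         ≮⇒≥; ≰⇒>;
         n<1+n; n≤1+n; suc-injective; m≤n⇒m<n∨m≡n; ⊓-sel; ⊓-glb; ⊓-monoˡ-≤; m⊓n≤m; m⊓n≤n;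
         m≤n⇒m⊓n≡m; m≥n⇒m⊓n≡n; +-identityʳ; *-comm; *-suc)
open import Data.Nat.DivMod using (_%_; m*n%n≡0; [m+kn]%n≡m%n)
open import Data.Fin as Fin using (Fin; toℕ; fromℕ; fromℕ<; inject₁; punchOut; _≟_)
open import Data.Fin.Properties
  using (toℕ-injective; toℕ<n; toℕ-fromℕ; toℕ-fromℕ<; toℕ-inject₁;
         any?; injective⇒≤; punchOut-injective)
open import Data.Vec using (Vec; []; _∷_; _∷ʳ_; lookup; tabulate)
open import Data.Vec.Properties using (lookup∘tabulate; tabulate∘lookup; tabulate-cong)
open import Data.List as List using (map; _++_)
open import Data.List.Properties using (length-map; length-++)
open import Data.List.Membership.Propositional using (_∈_)
open import Data.List.Membership.Propositional.Properties using (∈-map⁺; ∈-map⁻; ++-∈⇔)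
open import Data.List.Relation.Unary.Any using (here)
open import Data.List.Relation.Unary.All using ([])
open import Data.List.Relation.Unary.Unique.Propositional using ([]; _∷_)
import Data.List.Relation.Unary.Unique.Propositional.Properties as Unique
open import Data.Product using (∃; _×_; _,_; proj₁; proj₂)
open import Data.Sum using (_⊎_; inj₁; inj₂; [_,_])
open import Data.Sum.Function.Propositional using (_⊎-⇔_)
open import Data.Empty using (⊥)
open import Relation.Nullary using (yes; no; contradiction)
open import Relation.Binary.PropositionalEquality
  using (_≡_; _≢_; refl; sym; trans; cong; cong₂; subst; subst₂; module ≡-Reasoning)
open import Function using (_∘_)
open import Function.Bundles using (_⇔_; mk⇔; Equivalence)
open import Function.Properties.Equivalence using () renaming (trans to ⇔-trans)

module _ {A : Set} where

  HasCard-resp : {P Q : A → Set} {N : ℕ} → (∀ x → P x ⇔ Q x) → HasCard P N → HasCard Q N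
  HasCard-resp P⇔Q (xs , unique , mem , len) = xs , unique , (λ x → ⇔-trans (mem x) (P⇔Q x)) , len

  HasCard-⊎ : {P Q : A → Set} {N K : ℕ} → HasCard P N → HasCard Q K → (∀ x → P x → Q x → ⊥) →
              HasCard (λ x → P x ⊎ Q x) (N + K)
  HasCard-⊎ (xs , uxs , mxs , lxs) (ys , uys , mys , lys) disjoint =
    xs ++ ys ,
    Unique.++⁺ uxs uys (λ (x∈xs , x∈ys) →
      disjoint _ (Equivalence.to (mxs _) x∈xs) (Equivalence.to (mys _) x∈ys)) ,
    (λ x → ⇔-trans ++-∈⇔ (mxs x ⊎-⇔ mys x)) ,
    trans (length-++ xs) (cong₂ _+_ lxs lys)

HasCard-bijection : {A B : Set} {P : A → Set} {Q : B → Set} (f : A → B) (g : B → A) →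
                    (∀ {x} → P x → Q (f x)) → (∀ {y} → Q y → P (g y)) →
                    (∀ x → g (f x) ≡ x) → (∀ {y} → Q y → f (g y) ≡ y) →
                    {N : ℕ} → HasCard P N → HasCard Q N
HasCard-bijection {Q = Q} f g Pf Qg gf fg (xs , unique , mem , len) =
  map f xs , Unique.map⁺ f-injective unique , (λ y → mk⇔ (to y) (from y)) , trans (length-map f xs) len
  where
  f-injective : ∀ {x x′} → f x ≡ f x′ → x ≡ x′
  f-injective {x} {x′} e = trans (sym (gf x)) (trans (cong g e) (gf x′))
  to : ∀ y → y ∈ map f xs → Q y
  to y y∈ with ∈-map⁻ f y∈
  ... | x , x∈xs , refl = Pf (Equivalence.to (mem x) x∈xs)
  from : ∀ y → Q y → y ∈ map f xs
  from y q = subst (_∈ map f xs) (fg q) (∈-map⁺ f (Equivalence.from (mem (g y)) (Qg q)))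

m⊓n<n⇒m⊓n≡m : ∀ m n → m ⊓ n < n → m ⊓ n ≡ m
m⊓n<n⇒m⊓n≡m m n m⊓n<n with ⊓-sel m n
... | inj₁ m⊓n≡m = m⊓n≡m
... | inj₂ m⊓n≡n = contradiction m⊓n≡n (<⇒≢ m⊓n<n)

⊓-cancelʳ-< : ∀ {x y} n → x ⊓ n < y ⊓ n → x < y
⊓-cancelʳ-< n x⊓n<y⊓n = ≰⇒> λ y≤x → ≤⇒≯ (⊓-monoˡ-≤ n y≤x) x⊓n<y⊓n

three-values : ∀ {n x} → n ≤ x → x < 3 + n → x ≡ n ⊎ x ≡ 1 + n ⊎ x ≡ 2 + n
three-values n≤x x<3+n with m≤n⇒m<n∨m≡n n≤x
... | inj₂ n≡x = inj₁ (sym n≡x)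
... | inj₁ n<x with m≤n⇒m<n∨m≡n n<x
...   | inj₂ 1+n≡x = inj₂ (inj₁ (sym 1+n≡x))
...   | inj₁ 1+n<x = inj₂ (inj₂ (≤-antisym (s≤s⁻¹ x<3+n) 1+n<x))

DumontAt : ℕ → ℕ → Set
DumontAt p v = (p % 2 ≡ 1 → v < p) × (p % 2 ≡ 0 → p ≤ v)

dumontAt-even : ∀ {p v} → p % 2 ≡ 0 → p ≤ v → DumontAt p v
dumontAt-even p-even p≤v = (λ p-odd → contradiction (trans (sym p-even) p-odd) λ ()) , λ _ → p≤v

dumontAt-odd : ∀ {p v} → p % 2 ≡ 1 → v < p → DumontAt p v
dumontAt-odd p-odd v<p = (λ _ → v<p) , (λ p-even → contradiction (trans (sym p-even) p-odd) λ ())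

DumontAt-⊓ : ∀ {p v} n → p ≤ n → DumontAt p v → DumontAt p (v ⊓ n)
DumontAt-⊓ {v = v} n p≤n (odd , even) =
  (λ p-odd → ≤-<-trans (m⊓n≤m v n) (odd p-odd)) , (λ p-even → ⊓-glb (even p-even) p≤n)

Word : ℕ → Set
Word M = Vec (Fin M) M

D231 : (M : ℕ) → Word M → Set
D231 M σ = IsPerm σ × IsDumont2 σ × Avoids231 σ

infix 8 _!_
_!_ : ∀ {M} → Word M → Fin M → ℕ
σ ! i = toℕ (lookup σ i)

Word-ext : ∀ {M} {σ σ′ : Word M} → (∀ i → σ ! i ≡ σ′ ! i) → σ ≡ σ′
Word-ext {σ = σ} {σ′} eq =
  trans (sym (tabulate∘lookup σ)) (trans (tabulate-cong (toℕ-injective ∘ eq)) (tabulate∘lookup σ′))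

!-injective : ∀ {M} (σ : Word M) → IsPerm σ → ∀ {i i′} → σ ! i ≡ σ ! i′ → i ≡ i′
!-injective σ σ-perm = σ-perm ∘ toℕ-injective

IsPerm⇒surjective : ∀ {M} (σ : Word M) → IsPerm σ → ∀ y → ∃ λ i → lookup σ i ≡ y
IsPerm⇒surjective {suc M} σ σ-injective y with any? (λ i → lookup σ i ≟ y)
... | yes hit = hit
... | no  miss = contradiction (injective⇒≤ squeezed-injective) (<-irrefl refl)
  where
  squeezed : Fin (suc M) → Fin M
  squeezed i = punchOut {i = y} λ e → miss (i , sym e)
  squeezed-injective : ∀ {i i′} → squeezed i ≡ squeezed i′ → i ≡ i′
  squeezed-injective {i} {i′} e =
    σ-injective (punchOut-injective (λ e′ → miss (i , sym e′)) (λ e′ → miss (i′ , sym e′)) e)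

locate : ∀ {M} (σ : Word M) → IsPerm σ → ∀ {v} → v < M → ∃ λ i → σ ! i ≡ v
locate σ σ-perm v<M with IsPerm⇒surjective σ σ-perm (fromℕ< v<M)
... | i , σi≡v = i , trans (cong toℕ σi≡v) (toℕ-fromℕ< v<M)

pre : ∀ {m} → Fin m → Fin (2 + m)
pre j = inject₁ (inject₁ j)

penPos ultPos : ∀ m → Fin (2 + m)
penPos m = inject₁ (fromℕ m)
ultPos m = fromℕ (suc m)

toℕ-pre : ∀ {m} (j : Fin m) → toℕ (pre j) ≡ toℕ j
toℕ-pre j = trans (toℕ-inject₁ (inject₁ j)) (toℕ-inject₁ j)

toℕ-penPos : ∀ m → toℕ (penPos m) ≡ m
toℕ-penPos m = trans (toℕ-inject₁ (fromℕ m)) (toℕ-fromℕ m)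

toℕ-ultPos : ∀ m → toℕ (ultPos m) ≡ suc m
toℕ-ultPos m = toℕ-fromℕ (suc m)

data Position {m : ℕ} : Fin (2 + m) → Set where
  at-pre : (j : Fin m) → Position (pre j)
  at-pen : Position (penPos m)
  at-ult : Position (ultPos m)

position : ∀ {m} (i : Fin (2 + m)) → Position i
position {zero}  Fin.zero           = at-pen
position {zero}  (Fin.suc Fin.zero) = at-ult
position {suc m} Fin.zero           = at-pre Fin.zero
position {suc m} (Fin.suc i) with position i
... | at-pre j = at-pre (Fin.suc j)
... | at-pen   = at-pen
... | at-ult   = at-ult

module _ {m : ℕ} where

  pre<pen : (j : Fin m) → toℕ (pre j) < toℕ (penPos m)
  pre<pen j = subst₂ _<_ (sym (toℕ-pre j)) (sym (toℕ-penPos m)) (toℕ<n j)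

  pen<ult : toℕ (penPos m) < toℕ (ultPos m)
  pen<ult = subst₂ _<_ (sym (toℕ-penPos m)) (sym (toℕ-ultPos m)) (n<1+n m)

  pre<ult : (j : Fin m) → toℕ (pre j) < toℕ (ultPos m)
  pre<ult j = <-trans (pre<pen j) pen<ult

  pre-injective : {i j : Fin m} → pre i ≡ pre j → i ≡ j
  pre-injective {i} {j} e = toℕ-injective (trans (sym (toℕ-pre i)) (trans (cong toℕ e) (toℕ-pre j)))

  pre-mono : {i j : Fin m} → toℕ i < toℕ j → toℕ (pre i) < toℕ (pre j)
  pre-mono {i} {j} = subst₂ _<_ (sym (toℕ-pre i)) (sym (toℕ-pre j))

  ult-is-last : (k : Fin (2 + m)) → toℕ (ultPos m) < toℕ k → ⊥
  ult-is-last k ult<k = ≤⇒≯ (s≤s⁻¹ (toℕ<n k)) (subst (_< toℕ k) (toℕ-ultPos m) ult<k)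

  pen-after-pre : (j : Fin m) → toℕ (penPos m) < toℕ (pre j) → ⊥
  pen-after-pre j pen<pre = <-irrefl refl (<-trans pen<pre (pre<pen j))

lookup-∷ʳ-inject₁ : ∀ {k} {A : Set} (xs : Vec A k) x i → lookup (xs ∷ʳ x) (inject₁ i) ≡ lookup xs i
lookup-∷ʳ-inject₁ (_ ∷ xs) x Fin.zero    = refl
lookup-∷ʳ-inject₁ (_ ∷ xs) x (Fin.suc i) = lookup-∷ʳ-inject₁ xs x i

lookup-∷ʳ-fromℕ : ∀ {k} {A : Set} (xs : Vec A k) x → lookup (xs ∷ʳ x) (fromℕ k) ≡ x
lookup-∷ʳ-fromℕ []       x = refl
lookup-∷ʳ-fromℕ (_ ∷ xs) x = lookup-∷ʳ-fromℕ xs x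

module AppendTwo {k} {A : Set} (xs : Vec A k) (a b : A) where

  lookup-pre : ∀ j → lookup (xs ∷ʳ a ∷ʳ b) (pre j) ≡ lookup xs j
  lookup-pre j = trans (lookup-∷ʳ-inject₁ (xs ∷ʳ a) b (inject₁ j)) (lookup-∷ʳ-inject₁ xs a j)

  lookup-pen : lookup (xs ∷ʳ a ∷ʳ b) (penPos k) ≡ a
  lookup-pen = trans (lookup-∷ʳ-inject₁ (xs ∷ʳ a) b (fromℕ k)) (lookup-∷ʳ-fromℕ xs a)

  lookup-ult : lookup (xs ∷ʳ a ∷ʳ b) (ultPos k) ≡ b
  lookup-ult = lookup-∷ʳ-fromℕ (xs ∷ʳ a) b

module _ {m : ℕ} (σ : Word (2 + m)) where

  IsPerm-split : (∀ j j′ → σ ! pre j ≡ σ ! pre j′ → j ≡ j′) →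
                 (∀ j → σ ! pre j ≢ σ ! penPos m) → (∀ j → σ ! pre j ≢ σ ! ultPos m) →
                 σ ! penPos m ≢ σ ! ultPos m → IsPerm σ
  IsPerm-split pre-inj pre≢pen pre≢ult pen≢ult {x} {y} e = go (position x) (position y) (cong toℕ e)
    where
    go : ∀ {x y} → Position x → Position y → σ ! x ≡ σ ! y → x ≡ y
    go (at-pre j) (at-pre j′) e = cong pre (pre-inj j j′ e)
    go (at-pre j) at-pen      e = contradiction e (pre≢pen j)
    go (at-pre j) at-ult      e = contradiction e (pre≢ult j)
    go at-pen     (at-pre j)  e = contradiction (sym e) (pre≢pen j)
    go at-pen     at-pen      _ = refl
    go at-pen     at-ult      e = contradiction e pen≢ult
    go at-ult     (at-pre j)  e = contradiction (sym e) (pre≢ult j)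
    go at-ult     at-pen      e = contradiction (sym e) pen≢ult
    go at-ult     at-ult      _ = refl

  IsDumont2-split : (∀ j → DumontAt (toℕ j) (σ ! pre j)) →
                    DumontAt m (σ ! penPos m) → DumontAt (suc m) (σ ! ultPos m) → IsDumont2 σ
  IsDumont2-split dumont-pre dumont-pen dumont-ult x = go (position x)
    where
    go : ∀ {x} → Position x → DumontAt (toℕ x) (σ ! x)
    go (at-pre j) = subst (λ p → DumontAt p (σ ! pre j)) (sym (toℕ-pre j)) (dumont-pre j)
    go at-pen     = subst (λ p → DumontAt p (σ ! penPos m)) (sym (toℕ-penPos m)) dumont-pen
    go at-ult     = subst (λ p → DumontAt p (σ ! ultPos m)) (sym (toℕ-ultPos m)) dumont-ult

  No231Over : ℕ → Set
  No231Over v = ∀ i j → v < σ ! pre i → σ ! pre i < σ ! pre j → ⊥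

  Avoids231-split : (∀ i j k → toℕ i < toℕ j → toℕ j < toℕ k →
                       σ ! pre k < σ ! pre i → σ ! pre i < σ ! pre j → ⊥) →
                    No231Over (σ ! penPos m) → No231Over (σ ! ultPos m) →
                    (∀ i → σ ! ultPos m < σ ! pre i → σ ! pre i < σ ! penPos m → ⊥) →
                    Avoids231 σ
  Avoids231-split no231-pre no231-pen no231-ult no231-pen-ult (i , j , k , i<j , j<k , σk<σi , σi<σj) =
    go (position i) (position j) (position k) i<j j<k σk<σi σi<σj
    where
    go : ∀ {i j k} → Position i → Position j → Position k → toℕ i < toℕ j → toℕ j < toℕ k →
         σ ! k < σ ! i → σ ! i < σ ! j → ⊥
    go (at-pre a) (at-pre b) (at-pre c) a<b b<c =
      no231-pre a b c (subst₂ _<_ (toℕ-pre a) (toℕ-pre b) a<b) (subst₂ _<_ (toℕ-pre b) (toℕ-pre c) b<c)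
    go (at-pre a) (at-pre b) at-pen     _ _           = no231-pen a b
    go (at-pre a) (at-pre b) at-ult     _ _           = no231-ult a b
    go (at-pre a) at-pen     (at-pre c) _ pen<c _ _   = pen-after-pre c pen<c
    go (at-pre a) at-pen     at-pen     _ pen<pen _ _ = <-irrefl refl pen<pen
    go (at-pre a) at-pen     at-ult     _ _           = no231-pen-ult a
    go {k = k} _  at-ult     _          _ ult<k _ _   = ult-is-last k ult<k
    go at-pen     (at-pre b) _          pen<b _ _ _   = pen-after-pre b pen<b
    go at-pen     at-pen     _          pen<pen _ _ _ = <-irrefl refl pen<pen
    go {j = j} at-ult _      _          ult<j _ _ _   = ult-is-last j ult<j

final-descent-consecutive : ∀ {m} (σ : Word (2 + m)) → IsPerm σ → Avoids231 σ →
                            σ ! ultPos m < σ ! penPos m → σ ! penPos m ≡ suc (σ ! ultPos m)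
final-descent-consecutive {m} σ σ-perm σ-avoids ult<pen = ≤-antisym (≮⇒≥ no-gap) ult<pen
  where
  -- a value strictly between the last two entries sits earlier, and would play the role of the 2
  no-gap : suc (σ ! ultPos m) < σ ! penPos m → ⊥
  no-gap gap with locate σ σ-perm (<-trans gap (toℕ<n (lookup σ (penPos m))))
  ... | i , σi≡v = go (position i) σi≡v
    where
    go : ∀ {i} → Position i → σ ! i ≡ suc (σ ! ultPos m) → ⊥
    go (at-pre j) σj≡v = σ-avoids (pre j , penPos m , ultPos m , pre<pen j , pen<ult ,
                                   subst (σ ! ultPos m <_) (sym σj≡v) (n<1+n _) ,
                                   subst (_< σ ! penPos m) (sym σj≡v) gap)
    go at-pen σpen≡v = <-irrefl (sym σpen≡v) gap
    go at-ult σult≡v = <⇒≢ (n<1+n _) σult≡v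

D231-2 : HasCard (D231 2) 1
D231-2 = List.[ ω ] , [] ∷ [] , (λ σ → mk⇔ (λ { (here refl) → ω-D231 }) (here ∘ unique σ)) , refl
  where
  ω : Word 2
  ω = Fin.suc Fin.zero ∷ Fin.zero ∷ []
  ω-D231 : D231 2 ω
  ω-D231 = injective , dumont , avoids
    where
    injective : IsPerm ω
    injective {Fin.zero}         {Fin.zero}         _ = refl
    injective {Fin.suc Fin.zero} {Fin.suc Fin.zero} _ = refl
    injective {Fin.zero}         {Fin.suc Fin.zero} ()
    injective {Fin.suc Fin.zero} {Fin.zero}         ()
    dumont : IsDumont2 ω
    dumont Fin.zero           = dumontAt-even refl z≤n
    dumont (Fin.suc Fin.zero) = dumontAt-odd refl (s≤s z≤n)
    avoids : Avoids231 ω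
    avoids (i , j , k , i<j , j<k , _) =
      ≤⇒≯ (s≤s⁻¹ (toℕ<n k)) (≤-trans (s≤s (≤-trans (s≤s z≤n) i<j)) j<k)
  unique : ∀ σ → D231 2 σ → σ ≡ ω
  unique (Fin.suc Fin.zero ∷ Fin.zero ∷ []) _ = refl
  unique (Fin.zero ∷ Fin.zero ∷ []) (σ-perm , _) with σ-perm {Fin.zero} {Fin.suc Fin.zero} refl
  ... | ()
  unique (_ ∷ Fin.suc Fin.zero ∷ []) (_ , σ-dumont , _) with proj₁ (σ-dumont (Fin.suc Fin.zero)) refl
  ... | s≤s ()

-- Values are 0-based: words of D231 m have largest entry n, and words of D231 M end at positions m, m + 1.
module Step (n : ℕ) (m-even : suc n % 2 ≡ 0) (m+1-odd : suc (suc n) % 2 ≡ 1) where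

  m M : ℕ
  m = suc n
  M = 2 + m

  -- directSum: σ = π ⊕ 21, ending in (m + 1, m);
  -- bumpTop: the entry n of π becomes m + 1, and σ ends in (m, n).
  data Ending : Set where
    directSum bumpTop : Ending

  top ult pen : Ending → ℕ
  top directSum = n
  top bumpTop   = suc m
  ult directSum = m
  ult bumpTop   = n
  pen τ = suc (ult τ)

  n≤top : ∀ τ → n ≤ top τ
  n≤top directSum = ≤-refl
  n≤top bumpTop   = ≤-trans (n≤1+n n) (n≤1+n m)

  n≤ult : ∀ τ → n ≤ ult τ
  n≤ult directSum = n≤1+n n
  n≤ult bumpTop   = ≤-refl

  ult≤m : ∀ τ → ult τ ≤ m
  ult≤m directSum = ≤-refl
  ult≤m bumpTop   = n≤1+n n

  n≤pen : ∀ τ → n ≤ pen τ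
  n≤pen τ = ≤-trans (n≤ult τ) (n≤1+n (ult τ))

  m≤pen : ∀ τ → m ≤ pen τ
  m≤pen τ = s≤s (n≤ult τ)

  top<M : ∀ τ → top τ < M
  top<M directSum = <-trans (n<1+n n) (<-trans (n<1+n m) (n<1+n (suc m)))
  top<M bumpTop   = n<1+n (suc m)

  pen<M : ∀ τ → pen τ < M
  pen<M τ = s≤s (s≤s (ult≤m τ))

  ult<M : ∀ τ → ult τ < M
  ult<M τ = <-trans (n<1+n (ult τ)) (pen<M τ)

  top≢pen : ∀ τ → top τ ≢ pen τ
  top≢pen directSum = <⇒≢ (<-trans (n<1+n n) (n<1+n m))
  top≢pen bumpTop   = λ e → <⇒≢ (n<1+n m) (sym e)

  top≢ult : ∀ τ → top τ ≢ ult τ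
  top≢ult directSum = <⇒≢ (n<1+n n)
  top≢ult bumpTop   = λ e → <⇒≢ (<-trans (n<1+n n) (n<1+n m)) (sym e)

  only-top-remains : ∀ τ {x} → n ≤ x → x < M → x ≢ pen τ → x ≢ ult τ → x ≡ top τ
  only-top-remains directSum n≤x x<M x≢pen x≢ult with three-values n≤x x<M
  ... | inj₁ x≡n          = x≡n
  ... | inj₂ (inj₁ x≡m)   = contradiction x≡m x≢ult
  ... | inj₂ (inj₂ x≡m+1) = contradiction x≡m+1 x≢pen
  only-top-remains bumpTop   n≤x x<M x≢pen x≢ult with three-values n≤x x<M
  ... | inj₁ x≡n          = contradiction x≡n x≢ult
  ... | inj₂ (inj₁ x≡m)   = contradiction x≡m x≢pen
  ... | inj₂ (inj₂ x≡m+1) = x≡m+1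

  raise : Ending → Fin m → Fin M
  raise τ w with toℕ w <? n
  ... | yes _ = pre w
  ... | no  _ = fromℕ< (top<M τ)

  raise-cases : ∀ τ w → (toℕ w < n × toℕ (raise τ w) ≡ toℕ w) ⊎
                        (toℕ w ≡ n × toℕ (raise τ w) ≡ top τ)
  raise-cases τ w with toℕ w <? n
  ... | yes w<n = inj₁ (w<n , toℕ-pre w)
  ... | no  w≮n = inj₂ (≤-antisym (s≤s⁻¹ (toℕ<n w)) (≮⇒≥ w≮n) , toℕ-fromℕ< (top<M τ))

  raise-⊓ : ∀ τ w → toℕ (raise τ w) ⊓ n ≡ toℕ w
  raise-⊓ τ w with raise-cases τ w
  ... | inj₁ (w<n , r≡w)   = trans (cong (_⊓ n) r≡w) (m≤n⇒m⊓n≡m (<⇒≤ w<n))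
  ... | inj₂ (w≡n , r≡top) = trans (cong (_⊓ n) r≡top) (trans (m≥n⇒m⊓n≡n (n≤top τ)) (sym w≡n))

  raise-injective : ∀ τ {w w′} → toℕ (raise τ w) ≡ toℕ (raise τ w′) → w ≡ w′
  raise-injective τ {w} {w′} e =
    toℕ-injective (trans (sym (raise-⊓ τ w)) (trans (cong (_⊓ n) e) (raise-⊓ τ w′)))

  raise-reflects-< : ∀ τ {w w′} → toℕ (raise τ w) < toℕ (raise τ w′) → toℕ w < toℕ w′
  raise-reflects-< τ {w} {w′} r<r′ =
    ≤∧≢⇒< (subst₂ _≤_ (raise-⊓ τ w) (raise-⊓ τ w′) (⊓-monoˡ-≤ n (<⇒≤ r<r′)))
          (λ w≡w′ → <-irrefl (cong (toℕ ∘ raise τ) (toℕ-injective w≡w′)) r<r′)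

  raise-≥n : ∀ τ w → n ≤ toℕ (raise τ w) → toℕ (raise τ w) ≡ top τ
  raise-≥n τ w n≤r with raise-cases τ w
  ... | inj₁ (w<n , r≡w) = contradiction w<n (≤⇒≯ (subst (n ≤_) r≡w n≤r))
  ... | inj₂ (_ , r≡top) = r≡top

  raise≤top : ∀ τ w → toℕ (raise τ w) ≤ top τ
  raise≤top τ w with raise-cases τ w
  ... | inj₁ (w<n , r≡w) = subst (_≤ top τ) (sym r≡w) (≤-trans (<⇒≤ w<n) (n≤top τ))
  ... | inj₂ (_ , r≡top) = subst (_≤ top τ) (sym r≡top) ≤-refl

  ≤-raise : ∀ τ w → toℕ w ≤ toℕ (raise τ w)
  ≤-raise τ w with raise-cases τ w
  ... | inj₁ (_ , r≡w)     = subst (toℕ w ≤_) (sym r≡w) ≤-refl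
  ... | inj₂ (w≡n , r≡top) = subst₂ _≤_ (sym w≡n) (sym r≡top) (n≤top τ)

  raise≢ : ∀ τ w {v} → n ≤ v → top τ ≢ v → toℕ (raise τ w) ≢ v
  raise≢ τ w n≤v top≢v r≡v = top≢v (trans (sym (raise-≥n τ w (subst (n ≤_) (sym r≡v) n≤v))) r≡v)

  no-rise-above-n : ∀ τ {v} w w′ → n ≤ v →
                    v < toℕ (raise τ w) → toℕ (raise τ w) < toℕ (raise τ w′) → ⊥
  no-rise-above-n τ w w′ n≤v v<r r<r′ =
    ≤⇒≯ (raise≤top τ w′)
        (subst (_< toℕ (raise τ w′)) (raise-≥n τ w (≤-trans n≤v (<⇒≤ v<r))) r<r′)

  raise-DumontAt : ∀ τ {p} w → p ≤ n → DumontAt p (toℕ w) → DumontAt p (toℕ (raise τ w))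
  raise-DumontAt τ {p} w p≤n (odd , even) = odd′ , λ p-even → ≤-trans (even p-even) (≤-raise τ w)
    where
    odd′ : p % 2 ≡ 1 → toℕ (raise τ w) < p
    odd′ p-odd with raise-cases τ w
    ... | inj₁ (_ , r≡w) = subst (_< p) (sym r≡w) (odd p-odd)
    ... | inj₂ (w≡n , _) = contradiction (subst (_< p) w≡n (odd p-odd)) (≤⇒≯ p≤n)

  extend : Ending → Word m → Word M
  extend τ π = tabulate (raise τ ∘ lookup π) ∷ʳ fromℕ< (pen<M τ) ∷ʳ fromℕ< (ult<M τ)

  module _ (τ : Ending) (π : Word m) where
    open AppendTwo (tabulate (raise τ ∘ lookup π)) (fromℕ< (pen<M τ)) (fromℕ< (ult<M τ))

    extend-pre : ∀ j → extend τ π ! pre j ≡ toℕ (raise τ (lookup π j))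
    extend-pre j = cong toℕ (trans (lookup-pre j) (lookup∘tabulate (raise τ ∘ lookup π) j))

    extend-pen : extend τ π ! penPos m ≡ pen τ
    extend-pen = trans (cong toℕ lookup-pen) (toℕ-fromℕ< (pen<M τ))

    extend-ult : extend τ π ! ultPos m ≡ ult τ
    extend-ult = trans (cong toℕ lookup-ult) (toℕ-fromℕ< (ult<M τ))

  extend-D231 : ∀ τ π → D231 m π → D231 M (extend τ π)
  extend-D231 τ π (π-perm , π-dumont , π-avoids) =
    IsPerm-split σ prefix-injective
      (prefix≢ (penPos m) (extend-pen τ π) (n≤pen τ) (top≢pen τ))
      (prefix≢ (ultPos m) (extend-ult τ π) (n≤ult τ) (top≢ult τ))
      (λ e → <⇒≢ (n<1+n (ult τ)) (sym (trans (sym (extend-pen τ π)) (trans e (extend-ult τ π))))) ,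
    IsDumont2-split σ
      (λ j → subst (DumontAt (toℕ j)) (sym (σ-pre j))
                   (raise-DumontAt τ (lookup π j) (s≤s⁻¹ (toℕ<n j)) (π-dumont j)))
      (dumontAt-even m-even (subst (m ≤_) (sym (extend-pen τ π)) (m≤pen τ)))
      (dumontAt-odd m+1-odd (subst (_< suc m) (sym (extend-ult τ π)) (s≤s (ult≤m τ)))) ,
    Avoids231-split σ
      (λ i j k i<j j<k σk<σi σi<σj → π-avoids (i , j , k , i<j , j<k , reflect σk<σi , reflect σi<σj))
      (no231-over (penPos m) (extend-pen τ π) (n≤pen τ))
      (no231-over (ultPos m) (extend-ult τ π) (n≤ult τ))
      (λ i ult<σi σi<pen → ≤⇒≯ (s≤s⁻¹ (subst₂ _<_ (σ-pre i) (extend-pen τ π) σi<pen))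
                              (subst₂ _<_ (extend-ult τ π) (σ-pre i) ult<σi))
    where
    σ = extend τ π
    σ-pre = extend-pre τ π
    prefix-injective : ∀ j j′ → σ ! pre j ≡ σ ! pre j′ → j ≡ j′
    prefix-injective j j′ e = π-perm (raise-injective τ (trans (sym (σ-pre j)) (trans e (σ-pre j′))))
    prefix≢ : ∀ x {v} → σ ! x ≡ v → n ≤ v → top τ ≢ v → ∀ j → σ ! pre j ≢ σ ! x
    prefix≢ _ σx≡v n≤v top≢v j e =
      raise≢ τ (lookup π j) n≤v top≢v (trans (sym (σ-pre j)) (trans e σx≡v))
    reflect : ∀ {i j} → σ ! pre i < σ ! pre j → toℕ (lookup π i) < toℕ (lookup π j)
    reflect {i} {j} = raise-reflects-< τ ∘ subst₂ _<_ (σ-pre i) (σ-pre j)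
    no231-over : ∀ x {v} → σ ! x ≡ v → n ≤ v → No231Over σ (σ ! x)
    no231-over _ σx≡v n≤v i j v<σi σi<σj = no-rise-above-n τ (lookup π i) (lookup π j) n≤v
      (subst₂ _<_ σx≡v (σ-pre i) v<σi) (subst₂ _<_ (σ-pre i) (σ-pre j) σi<σj)

  PrefixTop : ℕ → Word M → Set
  PrefixTop c σ = ∀ j → n ≤ σ ! pre j → σ ! pre j ≡ c

  Shape : Ending → Word M → Set
  Shape τ σ = σ ! penPos m ≡ pen τ × σ ! ultPos m ≡ ult τ × PrefixTop (top τ) σ

  extend-Shape : ∀ τ π → Shape τ (extend τ π)
  extend-Shape τ π = extend-pen τ π , extend-ult τ π ,
    λ j n≤σj →
      trans (extend-pre τ π j) (raise-≥n τ (lookup π j) (subst (n ≤_) (extend-pre τ π j) n≤σj))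

  ending : ∀ σ → D231 M σ → ∃ λ τ → σ ! penPos m ≡ pen τ × σ ! ultPos m ≡ ult τ
  ending σ (σ-perm , σ-dumont , σ-avoids) =
    by-pen (m≤n⇒m<n∨m≡n (s≤s⁻¹ (toℕ<n (lookup σ (penPos m)))))
    where
    m≤σpen : m ≤ σ ! penPos m
    m≤σpen = subst (_≤ σ ! penPos m) (toℕ-penPos m)
               (proj₂ (σ-dumont (penPos m)) (subst (λ p → p % 2 ≡ 0) (sym (toℕ-penPos m)) m-even))
    σult<m+1 : σ ! ultPos m < suc m
    σult<m+1 = subst (σ ! ultPos m <_) (toℕ-ultPos m)
                 (proj₁ (σ-dumont (ultPos m)) (subst (λ p → p % 2 ≡ 1) (sym (toℕ-ultPos m)) m+1-odd))
    consecutive : σ ! penPos m ≡ suc (σ ! ultPos m)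
    consecutive = final-descent-consecutive σ σ-perm σ-avoids
      (≤∧≢⇒< (≤-trans (s≤s⁻¹ σult<m+1) m≤σpen)
             (λ e → <⇒≢ pen<ult (cong toℕ (!-injective σ σ-perm (sym e)))))
    with-pen : ∀ τ → σ ! penPos m ≡ pen τ → ∃ λ τ → σ ! penPos m ≡ pen τ × σ ! ultPos m ≡ ult τ
    with-pen τ σpen≡ = τ , σpen≡ , suc-injective (trans (sym consecutive) σpen≡)
    by-pen : σ ! penPos m < suc m ⊎ σ ! penPos m ≡ suc m →
             ∃ λ τ → σ ! penPos m ≡ pen τ × σ ! ultPos m ≡ ult τ
    by-pen (inj₁ σpen<m+1) = with-pen bumpTop (≤-antisym (s≤s⁻¹ σpen<m+1) m≤σpen)
    by-pen (inj₂ σpen≡m+1) = with-pen directSum σpen≡m+1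

  shape : ∀ σ → D231 M σ → ∃ λ τ → Shape τ σ
  shape σ σ∈@(σ-perm , _ , _) with ending σ σ∈
  ... | τ , σpen≡ , σult≡ = τ , σpen≡ , σult≡ , λ j n≤σj →
    only-top-remains τ n≤σj (toℕ<n (lookup σ (pre j)))
      (λ e → <⇒≢ (pre<pen j) (cong toℕ (!-injective σ σ-perm (trans e (sym σpen≡)))))
      (λ e → <⇒≢ (pre<ult j) (cong toℕ (!-injective σ σ-perm (trans e (sym σult≡)))))

  cap : Fin M → Fin m
  cap w = fromℕ< (s≤s (m⊓n≤n (toℕ w) n))

  restrict : Word M → Word m
  restrict σ = tabulate (cap ∘ lookup σ ∘ pre)

  restrict-! : ∀ σ j → restrict σ ! j ≡ σ ! pre j ⊓ n
  restrict-! σ j = trans (cong toℕ (lookup∘tabulate (cap ∘ lookup σ ∘ pre) j)) (toℕ-fromℕ< _)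

  restrict-extend : ∀ τ π → restrict (extend τ π) ≡ π
  restrict-extend τ π = Word-ext λ j →
    trans (restrict-! (extend τ π) j) (trans (cong (_⊓ n) (extend-pre τ π j)) (raise-⊓ τ (lookup π j)))

  extend-restrict-pre : ∀ τ σ → PrefixTop (top τ) σ → ∀ j → extend τ (restrict σ) ! pre j ≡ σ ! pre j
  extend-restrict-pre τ σ σ-top j with raise-cases τ (lookup (restrict σ) j)
  ... | inj₁ (w<n , r≡w) = begin
    extend τ (restrict σ) ! pre j         ≡⟨ extend-pre τ (restrict σ) j ⟩
    toℕ (raise τ (lookup (restrict σ) j)) ≡⟨ r≡w ⟩
    restrict σ ! j                        ≡⟨ restrict-! σ j ⟩
    σ ! pre j ⊓ n                         ≡⟨ m⊓n<n⇒m⊓n≡m _ n (subst (_< n) (restrict-! σ j) w<n) ⟩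
    σ ! pre j                             ∎
    where open ≡-Reasoning
  ... | inj₂ (w≡n , r≡top) = begin
    extend τ (restrict σ) ! pre j         ≡⟨ extend-pre τ (restrict σ) j ⟩
    toℕ (raise τ (lookup (restrict σ) j)) ≡⟨ r≡top ⟩
    top τ                                 ≡⟨ sym (σ-top j n≤σj) ⟩
    σ ! pre j                             ∎
    where
    open ≡-Reasoning
    n≤σj : n ≤ σ ! pre j
    n≤σj = subst (_≤ σ ! pre j) (trans (sym (restrict-! σ j)) w≡n) (m⊓n≤m _ n)

  extend-restrict : ∀ τ σ → Shape τ σ → extend τ (restrict σ) ≡ σ
  extend-restrict τ σ (σpen≡ , σult≡ , σ-top) = Word-ext λ i → at (position i)
    where
    at : ∀ {i} → Position i → extend τ (restrict σ) ! i ≡ σ ! i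
    at (at-pre j) = extend-restrict-pre τ σ σ-top j
    at at-pen     = trans (extend-pen τ (restrict σ)) (sym σpen≡)
    at at-ult     = trans (extend-ult τ (restrict σ)) (sym σult≡)

  restrict-D231 : ∀ τ σ → D231 M σ → PrefixTop (top τ) σ → D231 m (restrict σ)
  restrict-D231 τ σ (σ-perm , σ-dumont , σ-avoids) σ-top = injective , dumont , avoids
    where
    ρ = restrict σ
    injective : IsPerm ρ
    injective {j} {j′} e = pre-injective (!-injective σ σ-perm (begin
      σ ! pre j                   ≡⟨ sym (extend-restrict-pre τ σ σ-top j) ⟩
      extend τ ρ ! pre j          ≡⟨ extend-pre τ ρ j ⟩
      toℕ (raise τ (lookup ρ j))  ≡⟨ cong (toℕ ∘ raise τ) e ⟩
      toℕ (raise τ (lookup ρ j′)) ≡⟨ sym (extend-pre τ ρ j′) ⟩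
      extend τ ρ ! pre j′         ≡⟨ extend-restrict-pre τ σ σ-top j′ ⟩
      σ ! pre j′                  ∎))
      where open ≡-Reasoning
    dumont : IsDumont2 ρ
    dumont j = subst (DumontAt (toℕ j)) (sym (restrict-! σ j)) (DumontAt-⊓ n (s≤s⁻¹ (toℕ<n j))
                 (subst (λ p → DumontAt p (σ ! pre j)) (toℕ-pre j) (σ-dumont (pre j))))
    lift : ∀ {a b} → ρ ! a < ρ ! b → σ ! pre a < σ ! pre b
    lift {a} {b} = ⊓-cancelʳ-< n ∘ subst₂ _<_ (restrict-! σ a) (restrict-! σ b)
    avoids : Avoids231 ρ
    avoids (i , j , k , i<j , j<k , ρk<ρi , ρi<ρj) =
      σ-avoids (pre i , pre j , pre k , pre-mono i<j , pre-mono j<k , lift ρk<ρi , lift ρi<ρj)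

  Ended : Ending → Word M → Set
  Ended τ σ = D231 M σ × Shape τ σ

  count-Ended : ∀ τ {N} → HasCard (D231 m) N → HasCard (Ended τ) N
  count-Ended τ = HasCard-bijection (extend τ) restrict
    (λ {π} π∈ → extend-D231 τ π π∈ , extend-Shape τ π)
    (λ {σ} (σ∈ , _ , _ , σ-top) → restrict-D231 τ σ σ∈ σ-top)
    (restrict-extend τ)
    (λ {σ} (_ , σ-shape) → extend-restrict τ σ σ-shape)

  step : ∀ {N} → HasCard (D231 m) N → HasCard (D231 M) (N + N)
  step h = HasCard-resp by-ending (HasCard-⊎ (count-Ended directSum h) (count-Ended bumpTop h) endings-differ)
    where
    endings-differ : ∀ σ → Ended directSum σ → Ended bumpTop σ → ⊥
    endings-differ σ (_ , σpen≡m+1 , _) (_ , σpen≡m , _) = <⇒≢ (n<1+n m) (trans (sym σpen≡m) σpen≡m+1)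
    classify : ∀ σ → D231 M σ → Ended directSum σ ⊎ Ended bumpTop σ
    classify σ σ∈ with shape σ σ∈
    ... | directSum , σ-shape = inj₁ (σ∈ , σ-shape)
    ... | bumpTop   , σ-shape = inj₂ (σ∈ , σ-shape)
    by-ending : ∀ σ → (Ended directSum σ ⊎ Ended bumpTop σ) ⇔ D231 M σ
    by-ending σ = mk⇔ [ proj₁ , proj₁ ] (classify σ)

theorem2p3 : (k : ℕ) → HasCard (InD2-231 (suc k)) (2 ^ k)
theorem2p3 zero    = D231-2
theorem2p3 (suc k) =
  subst₂ (λ M N → HasCard (D231 M) N) length≡ count≡ (Step.step _ m-even m+1-odd (theorem2p3 k))
  where
  length≡ : 2 + 2 * suc k ≡ 2 * suc (suc k)
  length≡ = sym (*-suc 2 (suc k))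
  count≡ : 2 ^ k + 2 ^ k ≡ 2 ^ suc k
  count≡ = cong (2 ^ k +_) (sym (+-identityʳ (2 ^ k)))
  m-even : 2 * suc k % 2 ≡ 0
  m-even = trans (cong (_% 2) (*-comm 2 (suc k))) (m*n%n≡0 (suc k) 2)
  m+1-odd : suc (2 * suc k) % 2 ≡ 1
  m+1-odd = trans (cong (λ x → suc x % 2) (*-comm 2 (suc k))) ([m+kn]%n≡m%n 1 (suc k) 2)
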